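{- Let $k$ be a positive integer and let $G$ be the complete bipartite graph $K_{k-1,k}$ with parts $A$ and $B$, where $|A|=k-1$ and $|B|=k$. Then $\chi_a(G)=k$. Moreover, for every $k$-acyclic colouring $f$ of $G$, (i) the vertices in $A$ receive pairwise distinct colours, and (ii) all vertices in $B$ receive the same colour, i.e. $f(b)=f(b')$ for all $b,b'\in B$.
   Context: All graphs are finite, simple and undirected. A $k$-acyclic colouring of $G$ is a function $f\colon V(G)\to\{0,\dots,k-1\}$ with $f(u)\neq f(v)$ for every edge $uv$ such that no cycle is bicoloured by $f$; $\chi_a(G)$ is the least $k$ such that $G$ admits a $k$-acyclic colouring. -}

module Defs where

open import Data.Nat using (ℕ; zero; suc; _<_; _∸_)
open import Data.Fin using (Fin; zero; suc; inject₁; fromℕ)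
open import Data.Sum using (_⊎_; inj₁; inj₂)
open import Data.Product using (_×_; Σ; ∃; ∃-syntax)
open import Data.Empty using (⊥)
open import Relation.Nullary using (¬_)
open import Relation.Binary.PropositionalEquality using (_≡_)
open import Function.Definitions using (Injective)

record Graph : Set₁ where
  field
    V   : Set
    Adj : V → V → Set

open Graph public

-- A cycle in G of length (suc n) with n ≥ 2, i.e. length ≥ 3:
-- distinct vertices c 0, …, c n with c i ~ c (i+1) and c n ~ c 0.
record Cycle (G : Graph) : Set where
  field
    n       : ℕ
    long    : 2 Data.Nat.≤ n
    vtx     : Fin (suc n) → V G
    inj     : Injective _≡_ _≡_ vtx
    step    : (i : Fin n) → Adj G (vtx (inject₁ i)) (vtx (suc i))
    close   : Adj G (vtx (fromℕ n)) (vtx zero)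

Proper : (G : Graph) (k : ℕ) → (V G → Fin k) → Set
Proper G k f = ∀ u v → Adj G u v → ¬ (f u ≡ f v)

Bicoloured : (G : Graph) (k : ℕ) → (V G → Fin k) → Cycle G → Set
Bicoloured G k f C =
  ∃[ c₁ ] ∃[ c₂ ] ((i : Fin (suc (Cycle.n C))) →
     (f (Cycle.vtx C i) ≡ c₁) ⊎ (f (Cycle.vtx C i) ≡ c₂))

AcyclicColouring : (G : Graph) (k : ℕ) → (V G → Fin k) → Set
AcyclicColouring G k f = Proper G k f × ((C : Cycle G) → ¬ Bicoloured G k f C)

HasAcyclicColouring : Graph → ℕ → Set
HasAcyclicColouring G k = ∃[ f ] AcyclicColouring G k f

ChiA≡ : Graph → ℕ → Set
ChiA≡ G k = HasAcyclicColouring G k × (∀ j → j < k → ¬ HasAcyclicColouring G j)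

data KAdj (p q : ℕ) : Fin p ⊎ Fin q → Fin p ⊎ Fin q → Set where
  ab : (a : Fin p) (b : Fin q) → KAdj p q (inj₁ a) (inj₂ b)
  ba : (a : Fin p) (b : Fin q) → KAdj p q (inj₂ b) (inj₁ a)

K : ℕ → ℕ → Graph
K p q = record { V = Fin p ⊎ Fin q ; Adj = KAdj p q }

-- In an acyclic colouring of K_{p,q} the sides A and B use disjoint sets of colours, and
-- they cannot both contain a repeated colour: repeats a, a′ in A and b, b′ in B bicolour the
-- 4-cycle a b a′ b′. With j ≤ q colours, B cannot be rainbow beside a colour of A, so A is
-- rainbow. For K_{k-1,k}, the k - 1 colours of A plus those of B must fit into j ≤ k colours,
-- which rules out j < k and, for j = k, forces B to be monochromatic. Conversely, a rainbow
-- A with one further colour on B is acyclic: a bicoloured cycle alternates its two colours,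
-- but each of its vertices in B is flanked by two distinct, differently coloured vertices of A.
{-# OPTIONS --safe #-}
module Submission where

open import Defs
open import Data.Nat using (ℕ; zero; suc; _+_; _≤_; _<_; _∸_; s≤s; z≤n)
open import Data.Nat.Properties using (≤-refl; ≤⇒≯; m≤n⇒m≤1+n)
open import Data.Fin using (Fin; zero; suc; inject₁; fromℕ; _≟_)
open import Data.Fin.Properties using (injective⇒≤; +↔⊎; fromℕ≢inject₁; inject₁-injective)
open import Data.Sum using (_⊎_; inj₁; inj₂; [_,_])
open import Data.Product using (_×_; _,_; proj₁; proj₂; ∃)
open import Data.Empty using (⊥-elim)
open import Function using (_∘_; const; Injection)
open import Function.Definitions using (Injective)
open import Function.Properties.Inverse using (↔⇒↣)
import Function.Construct.Composition as Compose
open import Relation.Nullary using (¬_; yes; no)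
open import Relation.Binary.PropositionalEquality using (_≡_; _≢_; refl; sym; cong; subst₂)

private
  variable
    m r j : ℕ

[,]-injective : {x : Fin m → Fin j} {y : Fin r → Fin j} →
  Injective _≡_ _≡_ x → Injective _≡_ _≡_ y → (∀ i l → x i ≢ y l) →
  Injective _≡_ _≡_ [ x , y ]
[,]-injective x-inj y-inj disjoint {inj₁ i} {inj₁ i′} e = cong inj₁ (x-inj e)
[,]-injective x-inj y-inj disjoint {inj₁ i} {inj₂ l}  e = ⊥-elim (disjoint i l e)
[,]-injective x-inj y-inj disjoint {inj₂ l} {inj₁ i}  e = ⊥-elim (disjoint i l (sym e))
[,]-injective x-inj y-inj disjoint {inj₂ l} {inj₂ l′} e = cong inj₂ (y-inj e)

disjoint-injections⇒+≤ : {x : Fin m → Fin j} {y : Fin r → Fin j} →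
  Injective _≡_ _≡_ x → Injective _≡_ _≡_ y → (∀ i l → x i ≢ y l) → m + r ≤ j
disjoint-injections⇒+≤ {m} x-inj y-inj disjoint = injective⇒≤
  (Compose.injective _≡_ _≡_ _≡_ (Injection.injective (↔⇒↣ (+↔⊎ {m})))
    ([,]-injective x-inj y-inj disjoint))

avoided-colour⇒< : {y : Fin r → Fin j} (c : Fin j) →
  Injective _≡_ _≡_ y → (∀ l → c ≢ y l) → r < j
avoided-colour⇒< c y-inj avoids =
  disjoint-injections⇒+≤ {x = const c} (λ { {zero} {zero} _ → refl }) y-inj (λ _ → avoids)

two-avoided-colours⇒2+≤ : {y : Fin r → Fin j} {c d : Fin j} → c ≢ d →
  Injective _≡_ _≡_ y → (∀ l → c ≢ y l) → (∀ l → d ≢ y l) → 2 + r ≤ j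
two-avoided-colours⇒2+≤ {j = j} {y = y} {c} {d} c≢d y-inj c-avoided d-avoided =
  disjoint-injections⇒+≤ {x = pair} pair-injective y-inj pair-avoided
  where
  pair : Fin 2 → Fin j
  pair zero       = c
  pair (suc zero) = d

  pair-injective : Injective _≡_ _≡_ pair
  pair-injective {zero}     {zero}     _ = refl
  pair-injective {zero}     {suc zero} e = ⊥-elim (c≢d e)
  pair-injective {suc zero} {zero}     e = ⊥-elim (c≢d (sym e))
  pair-injective {suc zero} {suc zero} _ = refl

  pair-avoided : ∀ i l → pair i ≢ y l
  pair-avoided zero       = c-avoided
  pair-avoided (suc zero) = d-avoided

alternating : {A : Set} {x y z c₁ c₂ : A} → x ≢ y → y ≢ z →
  (x ≡ c₁ ⊎ x ≡ c₂) → (y ≡ c₁ ⊎ y ≡ c₂) → (z ≡ c₁ ⊎ z ≡ c₂) → x ≡ z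
alternating x≢y y≢z (inj₁ refl) (inj₁ refl) _           = ⊥-elim (x≢y refl)
alternating x≢y y≢z (inj₂ refl) (inj₂ refl) _           = ⊥-elim (x≢y refl)
alternating x≢y y≢z _           (inj₁ refl) (inj₁ refl) = ⊥-elim (y≢z refl)
alternating x≢y y≢z _           (inj₂ refl) (inj₂ refl) = ⊥-elim (y≢z refl)
alternating x≢y y≢z (inj₁ refl) (inj₂ refl) (inj₁ refl) = refl
alternating x≢y y≢z (inj₂ refl) (inj₁ refl) (inj₂ refl) = refl

module _ {p q : ℕ} where

  K-triangle-free : ∀ {u v w} → KAdj p q u v → KAdj p q v w → ¬ KAdj p q w u
  K-triangle-free (ab a b) (ba a′ .b) ()
  K-triangle-free (ba a b) (ab .a b′) ()

  square : {a a′ : Fin p} {b b′ : Fin q} → a ≢ a′ → b ≢ b′ → Cycle (K p q)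
  square {a} {a′} {b} {b′} a≢a′ b≢b′ = record
    { n = 3 ; long = s≤s (s≤s z≤n) ; vtx = vtx ; inj = vtx-injective
    ; step = step ; close = ba a b′ }
    where
    vtx : Fin 4 → Fin p ⊎ Fin q
    vtx zero                   = inj₁ a
    vtx (suc zero)             = inj₂ b
    vtx (suc (suc zero))       = inj₁ a′
    vtx (suc (suc (suc zero))) = inj₂ b′

    vtx-injective : Injective _≡_ _≡_ vtx
    vtx-injective {zero}                 {zero}                 _    = refl
    vtx-injective {zero}                 {suc zero}             ()
    vtx-injective {zero}                 {suc (suc zero)}       refl = ⊥-elim (a≢a′ refl)
    vtx-injective {zero}                 {suc (suc (suc zero))} ()
    vtx-injective {suc zero}             {zero}                 ()
    vtx-injective {suc zero}             {suc zero}             _    = refl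
    vtx-injective {suc zero}             {suc (suc zero)}       ()
    vtx-injective {suc zero}             {suc (suc (suc zero))} refl = ⊥-elim (b≢b′ refl)
    vtx-injective {suc (suc zero)}       {zero}                 refl = ⊥-elim (a≢a′ refl)
    vtx-injective {suc (suc zero)}       {suc zero}             ()
    vtx-injective {suc (suc zero)}       {suc (suc zero)}       _    = refl
    vtx-injective {suc (suc zero)}       {suc (suc (suc zero))} ()
    vtx-injective {suc (suc (suc zero))} {zero}                 ()
    vtx-injective {suc (suc (suc zero))} {suc zero}             refl = ⊥-elim (b≢b′ refl)
    vtx-injective {suc (suc (suc zero))} {suc (suc zero)}       ()
    vtx-injective {suc (suc (suc zero))} {suc (suc (suc zero))} _    = refl

    step : (i : Fin 3) → KAdj p q (vtx (inject₁ i)) (vtx (suc i))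
    step zero             = ab a b
    step (suc zero)       = ba a′ b
    step (suc (suc zero)) = ab a′ b′

  module _ {j : ℕ} {f : Fin p ⊎ Fin q → Fin j} (acyclic : AcyclicColouring (K p q) j f) where

    sides-disjoint : ∀ a b → f (inj₁ a) ≢ f (inj₂ b)
    sides-disjoint a b = proj₁ acyclic (inj₁ a) (inj₂ b) (ab a b)

    no-repeats-on-both-sides : {a a′ : Fin p} {b b′ : Fin q} → a ≢ a′ → b ≢ b′ →
      f (inj₁ a) ≡ f (inj₁ a′) → ¬ f (inj₂ b) ≡ f (inj₂ b′)
    no-repeats-on-both-sides {a} {b = b} a≢a′ b≢b′ fa≡fa′ fb≡fb′ =
      proj₂ acyclic (square a≢a′ b≢b′) (f (inj₁ a) , f (inj₂ b) , two-coloured)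
      where
      two-coloured : (i : Fin 4) → let v = Cycle.vtx (square a≢a′ b≢b′) i in
        f v ≡ f (inj₁ a) ⊎ f v ≡ f (inj₂ b)
      two-coloured zero                   = inj₁ refl
      two-coloured (suc zero)             = inj₂ refl
      two-coloured (suc (suc zero))       = inj₁ (sym fa≡fa′)
      two-coloured (suc (suc (suc zero))) = inj₂ (sym fb≡fb′)

    colourA-injective : j ≤ q → Injective _≡_ _≡_ (f ∘ inj₁)
    colourA-injective j≤q {a} {a′} fa≡fa′ with a ≟ a′
    ... | yes a≡a′ = a≡a′
    ... | no a≢a′  = ⊥-elim (≤⇒≯ j≤q
      (avoided-colour⇒< (f (inj₁ a)) colourB-injective (sides-disjoint a)))
      where
      colourB-injective : Injective _≡_ _≡_ (f ∘ inj₂)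
      colourB-injective {b} {b′} fb≡fb′ with b ≟ b′
      ... | yes b≡b′ = b≡b′
      ... | no b≢b′  = ⊥-elim (no-repeats-on-both-sides a≢a′ b≢b′ fa≡fa′ fb≡fb′)

    p<colours : Fin q → j ≤ q → p < j
    p<colours b j≤q = avoided-colour⇒< (f (inj₂ b)) (colourA-injective j≤q)
      (λ a → sides-disjoint a b ∘ sym)

    colourB-constant : j ≤ q → j ≤ suc p → ∀ b b′ → f (inj₂ b) ≡ f (inj₂ b′)
    colourB-constant j≤q j≤1+p b b′ with f (inj₂ b) ≟ f (inj₂ b′)
    ... | yes fb≡fb′ = fb≡fb′
    ... | no fb≢fb′  = ⊥-elim (≤⇒≯ j≤1+p (two-avoided-colours⇒2+≤ fb≢fb′
      (colourA-injective j≤q) (λ a → sides-disjoint a b ∘ sym) (λ a → sides-disjoint a b′ ∘ sym)))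

rainbowColouring : (p q : ℕ) → Fin p ⊎ Fin q → Fin (suc p)
rainbowColouring p q = [ inject₁ , const (fromℕ p) ]

module _ {p q : ℕ} where

  private
    g : Fin p ⊎ Fin q → Fin (suc p)
    g = rainbowColouring p q

  rainbowColouring-proper : Proper (K p q) (suc p) g
  rainbowColouring-proper _ _ (ab a b) = fromℕ≢inject₁ ∘ sym
  rainbowColouring-proper _ _ (ba a b) = fromℕ≢inject₁

  private
    TwoColoured : Fin (suc p) → Fin (suc p) → Fin p ⊎ Fin q → Set
    TwoColoured c₁ c₂ v = g v ≡ c₁ ⊎ g v ≡ c₂

    two-coloured-path⇒middle-in-A : ∀ {u v w c₁ c₂} → KAdj p q u v → KAdj p q v w → u ≢ w →
      TwoColoured c₁ c₂ u → TwoColoured c₁ c₂ v → TwoColoured c₁ c₂ w → ∃ λ a → v ≡ inj₁ a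
    two-coloured-path⇒middle-in-A (ab a b) (ba a′ .b) u≢w cu cv cw = ⊥-elim (u≢w (cong inj₁
      (inject₁-injective (alternating (rainbowColouring-proper _ _ (ab a b))
        (rainbowColouring-proper _ _ (ba a′ b)) cu cv cw))))
    two-coloured-path⇒middle-in-A (ba a b) (ab .a b′) _ _ _ _ = a , refl

  rainbowColouring-acyclic : AcyclicColouring (K p q) (suc p) g
  rainbowColouring-acyclic = rainbowColouring-proper , no-bicoloured-cycle
    where
    0≢2 : ∀ {n} → _≢_ {A = Fin (3 + n)} zero (suc (suc zero))
    0≢2 ()

    1≢3 : ∀ {n} → _≢_ {A = Fin (4 + n)} (suc zero) (suc (suc (suc zero)))
    1≢3 ()

    no-bicoloured-cycle : (C : Cycle (K p q)) → ¬ Bicoloured (K p q) (suc p) g C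
    no-bicoloured-cycle record { n = zero ; long = () }
    no-bicoloured-cycle record { n = suc zero ; long = s≤s () }
    no-bicoloured-cycle record { n = suc (suc m) ; vtx = vtx ; inj = inj ; step = step ; close = close }
      (c₁ , c₂ , two) with m
    ... | zero = K-triangle-free (step zero) (step (suc zero)) close
    ... | suc _ with two-coloured-path⇒middle-in-A (step zero) (step (suc zero)) (λ e → 0≢2 (inj e))
                       (two zero) (two (suc zero)) (two (suc (suc zero)))
                   | two-coloured-path⇒middle-in-A (step (suc zero)) (step (suc (suc zero)))
                       (λ e → 1≢3 (inj e)) (two (suc zero)) (two (suc (suc zero))) (two (suc (suc (suc zero))))
    ...   | a , vtx₁≡a | a′ , vtx₂≡a′ with subst₂ (KAdj p q) vtx₁≡a vtx₂≡a′ (step (suc zero))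
    ...     | ()

mainTheorem18 : (k : ℕ) → 1 ≤ k →
    ChiA≡ (K (k ∸ 1) k) k
    × ((f : Fin (k ∸ 1) ⊎ Fin k → Fin k) → AcyclicColouring (K (k ∸ 1) k) k f →
        ((a a′ : Fin (k ∸ 1)) → f (inj₁ a) ≡ f (inj₁ a′) → a ≡ a′)
        × ((b b′ : Fin k) → f (inj₂ b) ≡ f (inj₂ b′)))
mainTheorem18 (suc p) _ =
  ((rainbowColouring p (suc p) , rainbowColouring-acyclic) , fewer-colours-impossible)
  , λ f acyclic → (λ a a′ → colourA-injective acyclic ≤-refl)
                , colourB-constant acyclic ≤-refl ≤-refl
  where
  fewer-colours-impossible : ∀ j → j < suc p → ¬ HasAcyclicColouring (K p (suc p)) j
  fewer-colours-impossible j (s≤s j≤p) (f , acyclic) =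
    ≤⇒≯ j≤p (p<colours acyclic zero (m≤n⇒m≤1+n j≤p))
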